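{- Let $n\ge1$ and $\bar o\in\mathcal O_n^n$. Consider the problems \[ P'(\bar o)\colon\quad \bar x\in\mathbb{Q}^n,\qquad \bar x\le\bar o(\bar x), \] \[ D'(\bar o)\colon\quad \bar y\in(\mathbb{Q}\cup\{+\infty\})^n\setminus\{+\infty\}^n,\qquad \bar y>\bar o(\bar y), \] where the inequalities hold component-wise and we stipulate that $+\infty>+\infty$. Then exactly one of $P'(\bar o)$ and $D'(\bar o)$ is satisfiable.
   Context: $\mathcal O_n$ denotes the class of functions $(\mathbb{Q}\cup\{+\infty\})^n\to\mathbb{Q}\cup\{+\infty\}$ of one of the following three forms, for some $m\ge1$, indices $j_1,\dots,j_m\in\{1,\dots,n\}$, rationals $k,k_1,\dots,k_m$ and positive rationals $\alpha_1,\dots,\alpha_m$: (i) $\bar x\mapsto\max(x_{j_1}+k_1,\dots,x_{j_m}+k_m)$; (ii) $\bar x\mapsto\min(x_{j_1}+k_1,\dots,x_{j_m}+k_m)$; (iii) $\bar x\mapsto\frac{\alpha_1x_{j_1}+\dots+\alpha_mx_{j_m}}{\alpha_1+\dots+\alpha_m}+k$. Usual conventions for $+\infty$: $+\infty+c=+\infty$, positive multiples and sums involving $+\infty$ equal $+\infty$, and $c<+\infty$ for every rational $c$. -}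

module Defs where

open import Data.Nat using (ℕ)
open import Data.Fin using (Fin)
open import Data.Product using (Σ; _×_; _,_; proj₁; proj₂)
open import Data.List.NonEmpty using (List⁺; _∷_)
open import Data.List using (List; []; _∷_)
open import Data.Rational using (ℚ; _+_; _*_; _⊔_; _⊓_; _÷_; Positive; _≤_; _<_)
open import Data.Rational.Properties using (pos⇒nonZero; pos+pos⇒pos)
open import Data.Unit using (⊤)
open import Data.Empty using (⊥)
open import Relation.Nullary using (¬_)
open import Relation.Binary.PropositionalEquality using (_≡_)

data ℚ∞ : Set where
  fin : ℚ → ℚ∞
  +∞  : ℚ∞

shift : ℚ∞ → ℚ → ℚ∞
shift (fin x) c = fin (x + c)
shift +∞      c = +∞

max∞ : ℚ∞ → ℚ∞ → ℚ∞
max∞ (fin a) (fin b) = fin (a ⊔ b)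
max∞ _       _       = +∞

min∞ : ℚ∞ → ℚ∞ → ℚ∞
min∞ (fin a) (fin b) = fin (a ⊓ b)
min∞ (fin a) +∞      = fin a
min∞ +∞      b       = b

ℚ⁺ : Set
ℚ⁺ = Σ ℚ Positive

-- The class O_n: (i) max form, (ii) min form, (iii) weighted-average form.
-- Each term is given by an index j and a constant k (resp. a weight α > 0).
data Op (n : ℕ) : Set where
  maxOp : List⁺ (Fin n × ℚ) → Op n
  minOp : List⁺ (Fin n × ℚ) → Op n
  avgOp : List⁺ (Fin n × ℚ⁺) → ℚ → Op n

totalWeight′ : {n : ℕ} → Fin n × ℚ⁺ → List (Fin n × ℚ⁺) → ℚ⁺
totalWeight′ (_ , a) [] = a
totalWeight′ (_ , (a , pa)) (t ∷ ts) with totalWeight′ t ts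
... | (b , pb) = (a + b) , pos+pos⇒pos a {{pa}} b {{pb}}

totalWeight : {n : ℕ} → List⁺ (Fin n × ℚ⁺) → ℚ⁺
totalWeight (t ∷ ts) = totalWeight′ t ts

weightedSum′ : {n : ℕ} → (Fin n → ℚ∞) → Fin n × ℚ⁺ → List (Fin n × ℚ⁺) → ℚ∞
weightedSum′ x (j , (a , _)) [] with x j
... | fin v = fin (a * v)
... | +∞    = +∞
weightedSum′ x (j , (a , _)) (t ∷ ts) with x j | weightedSum′ x t ts
... | fin v | fin s = fin (a * v + s)
... | _     | _     = +∞

weightedSum : {n : ℕ} → (Fin n → ℚ∞) → List⁺ (Fin n × ℚ⁺) → ℚ∞
weightedSum x (t ∷ ts) = weightedSum′ x t ts

maxTerms′ : {n : ℕ} → (Fin n → ℚ∞) → Fin n × ℚ → List (Fin n × ℚ) → ℚ∞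
maxTerms′ x (j , k) []       = shift (x j) k
maxTerms′ x (j , k) (t ∷ ts) = max∞ (shift (x j) k) (maxTerms′ x t ts)

maxTerms : {n : ℕ} → (Fin n → ℚ∞) → List⁺ (Fin n × ℚ) → ℚ∞
maxTerms x (t ∷ ts) = maxTerms′ x t ts

minTerms′ : {n : ℕ} → (Fin n → ℚ∞) → Fin n × ℚ → List (Fin n × ℚ) → ℚ∞
minTerms′ x (j , k) []       = shift (x j) k
minTerms′ x (j , k) (t ∷ ts) = min∞ (shift (x j) k) (minTerms′ x t ts)

minTerms : {n : ℕ} → (Fin n → ℚ∞) → List⁺ (Fin n × ℚ) → ℚ∞
minTerms x (t ∷ ts) = minTerms′ x t ts

eval : {n : ℕ} → Op n → (Fin n → ℚ∞) → ℚ∞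
eval (maxOp ts) x = maxTerms x ts
eval (minOp ts) x = minTerms x ts
eval (avgOp ts k) x with weightedSum x ts | totalWeight ts
... | fin s | (w , pw) = fin ((s ÷ w) {{pos⇒nonZero w {{pw}}}} + k)
... | +∞    | _        = +∞

-- order on ℚ ∪ {+∞}; by stipulation +∞ < +∞ holds
_≤∞_ : ℚ∞ → ℚ∞ → Set
fin a ≤∞ fin b = a ≤ b
_     ≤∞ +∞    = ⊤
+∞    ≤∞ fin _ = ⊥

_<∞_ : ℚ∞ → ℚ∞ → Set
fin a <∞ fin b = a < b
_     <∞ +∞    = ⊤
+∞    <∞ fin _ = ⊥

P′ : {n : ℕ} → (Fin n → Op n) → Set
P′ {n} o = Σ (Fin n → ℚ) λ x → (i : Fin n) → fin (x i) ≤∞ eval (o i) (λ j → fin (x j))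

D′ : {n : ℕ} → (Fin n → Op n) → Set
D′ {n} o = Σ (Fin n → ℚ∞) λ y →
  (¬ ((i : Fin n) → y i ≡ +∞)) × ((i : Fin n) → eval (o i) y <∞ y i)

-- Every operator of O_n is monotone and commutes with adding a constant to all coordinates.
-- Hence P′ and D′ exclude each other: if x solves P′ and y solves D′, let i minimise y_j − x_j =: b;
-- then x + b ≤ y, so y_i = x_i + b ≤ o_i(x) + b = o_i(x + b) ≤ o_i(y) < y_i.
-- That one of them is solvable follows by Fourier–Motzkin elimination. Each operator is a min-max
-- tree of affine forms whose positive weights sum to one; such trees are closed under substitution
-- for a variable, and x₀ ≤ e(x₀, x̄) is either unsatisfiable or equivalent to x₀ ≤ g(x̄) for such a
-- tree g. Substituting g for x₀ in the other inequalities leaves a system in one variable fewer,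
-- whose solutions lift: a primal one with x₀ = g(x̄), or x₀ large if g(x̄) = +∞; a dual one with
-- y₀ slightly above g(ȳ), or y₀ = +∞ if g(ȳ) = +∞, which is where +∞ > +∞ is used.

module Submission where

open import Defs
open import Data.Nat using (ℕ; zero; suc; _≤_)
open import Data.Fin using (Fin; zero; suc)
open import Data.Product using (_×_; Σ; _,_; proj₁; proj₂)
open import Data.Product.Function.NonDependent.Propositional using (_×-⇔_)
open import Data.Sum as Sum using (_⊎_; inj₁; inj₂; [_,_]′)
open import Data.Sum.Function.Propositional using (_⊎-⇔_)
open import Data.List using (List; []; _∷_; _++_; map)
open import Data.List.NonEmpty using (List⁺) renaming (_∷_ to _∷⁺_)
open import Data.Vec.Functional using () renaming (_∷_ to _∷ᶠ_)
open import Data.Unit using (tt)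
open import Data.Empty using (⊥)
open import Function using (_∘_)
open import Function.Bundles using (_⇔_; mk⇔; module Equivalence)
import Function.Properties.Equivalence as ⇔
open import Relation.Nullary using (¬_; yes; no)
open import Relation.Binary.PropositionalEquality
  using (_≡_; refl; sym; trans; cong; cong₂; subst; subst₂; module ≡-Reasoning)
open import Data.Rational
  using (ℚ; 0ℚ; 1ℚ; _+_; _*_; _-_; -_; _⊔_; _⊓_; 1/_; _÷_; Positive; NonNegative)
  renaming (_≤_ to _≤ℚ_; _<_ to _<ℚ_)
import Data.Rational.Properties as ℚ
open import Data.Rational.Solver using (module +-*-Solver)
open +-*-Solver using (solve; _:=_; _:+_; _:*_; _:-_; :-_)

open Equivalence using (to; from)
open ≡-Reasoning

private variable
  m k : ℕ

_⁻¹ : (w : ℚ) .{{_ : Positive w}} → ℚ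
w ⁻¹ = (1/ w) {{ℚ.pos⇒nonZero w}}

⁻¹-pos : ∀ w .{{_ : Positive w}} → Positive (w ⁻¹)
⁻¹-pos w = ℚ.1/pos⇒pos w

⁻¹-inverseˡ : ∀ w .{{_ : Positive w}} → w ⁻¹ * w ≡ 1ℚ
⁻¹-inverseˡ w = ℚ.*-inverseˡ w {{ℚ.pos⇒nonZero w}}

⁻¹*-cancel : ∀ w .{{_ : Positive w}} z → w ⁻¹ * (w * z) ≡ z
⁻¹*-cancel w z = begin
  w ⁻¹ * (w * z)  ≡⟨ ℚ.*-assoc (w ⁻¹) w z ⟨
  w ⁻¹ * w * z    ≡⟨ cong (_* z) (⁻¹-inverseˡ w) ⟩
  1ℚ * z          ≡⟨ ℚ.*-identityˡ z ⟩
  z               ∎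

*⁻¹-cancel : ∀ w .{{_ : Positive w}} z → w * (w ⁻¹ * z) ≡ z
*⁻¹-cancel w z = begin
  w * (w ⁻¹ * z)  ≡⟨ ℚ.*-assoc w (w ⁻¹) z ⟨
  w * w ⁻¹ * z    ≡⟨ cong (_* z) (ℚ.*-comm w (w ⁻¹)) ⟩
  w ⁻¹ * w * z    ≡⟨ ℚ.*-assoc (w ⁻¹) w z ⟩
  w ⁻¹ * (w * z)  ≡⟨ ⁻¹*-cancel w z ⟩
  z               ∎

*-≤⇔≤-⁻¹* : ∀ w .{{_ : Positive w}} t s → w * t ≤ℚ s ⇔ t ≤ℚ w ⁻¹ * s
*-≤⇔≤-⁻¹* w t s = mk⇔
  (λ wt≤s → subst (_≤ℚ w ⁻¹ * s) (⁻¹*-cancel w t)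
    (ℚ.*-monoˡ-≤-nonNeg (w ⁻¹) {{ℚ.pos⇒nonNeg (w ⁻¹) {{⁻¹-pos w}}}} wt≤s))
  (λ t≤w⁻¹s → subst (w * t ≤ℚ_) (*⁻¹-cancel w s)
    (ℚ.*-monoˡ-≤-nonNeg w {{ℚ.pos⇒nonNeg w}} t≤w⁻¹s))

+-cancelˡ-≤ : ∀ r {p q} → r + p ≤ℚ r + q → p ≤ℚ q
+-cancelˡ-≤ r {p} {q} r+p≤r+q = subst₂ _≤ℚ_ (cancel p) (cancel q) (ℚ.+-monoʳ-≤ (- r) r+p≤r+q)
  where
  cancel : ∀ z → - r + (r + z) ≡ z
  cancel z = solve 2 (λ r z → :- r :+ (r :+ z) := z) refl r z

≤-absorb : ∀ β w t s c → β + w ≡ 1ℚ → t ≤ℚ β * t + s + c ⇔ w * t ≤ℚ s + c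
≤-absorb β w t s c β+w≡1 = mk⇔
  (λ t≤ → +-cancelˡ-≤ (β * t) (subst₂ _≤ℚ_ t≡βt+wt (ℚ.+-assoc (β * t) s c) t≤))
  (λ wt≤ → subst₂ _≤ℚ_ (sym t≡βt+wt) (sym (ℚ.+-assoc (β * t) s c)) (ℚ.+-monoʳ-≤ (β * t) wt≤))
  where
  t≡βt+wt : t ≡ β * t + w * t
  t≡βt+wt = begin
    t              ≡⟨ ℚ.*-identityˡ t ⟨
    1ℚ * t         ≡⟨ cong (_* t) β+w≡1 ⟨
    (β + w) * t    ≡⟨ ℚ.*-distribʳ-+ t β w ⟩
    β * t + w * t  ∎

p<p+q : ∀ p {q} → 0ℚ <ℚ q → p <ℚ p + q
p<p+q p {q} 0<q = subst (_<ℚ p + q) (ℚ.+-identityʳ p) (ℚ.+-monoʳ-< p 0<q)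

positiveLowerBound : (f : Fin k → ℚ) → (∀ i → 0ℚ <ℚ f i) →
  Σ ℚ λ ε → 0ℚ <ℚ ε × ∀ i → ε ≤ℚ f i
positiveLowerBound {zero}  f _   = 1ℚ , ℚ.positive⁻¹ 1ℚ , λ ()
positiveLowerBound {suc k} f f>0 with positiveLowerBound (f ∘ suc) (f>0 ∘ suc)
... | ε , ε>0 , ε≤f = f zero ⊓ ε , min>0 , λ where
    zero    → ℚ.p⊓q≤p (f zero) ε
    (suc i) → ℚ.≤-trans (ℚ.p⊓q≤q (f zero) ε) (ε≤f i)
  where
  min>0 : 0ℚ <ℚ f zero ⊓ ε
  min>0 = [ (λ e → subst (0ℚ <ℚ_) (sym e) (f>0 zero)) , (λ e → subst (0ℚ <ℚ_) (sym e) ε>0) ]′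
    (ℚ.⊓-sel (f zero) ε)

≤∞-refl : ∀ a → a ≤∞ a
≤∞-refl (fin a) = ℚ.≤-refl
≤∞-refl +∞      = tt

≤∞-+∞ : ∀ a → a ≤∞ +∞
≤∞-+∞ (fin _) = tt
≤∞-+∞ +∞      = tt

<∞-+∞ : ∀ a → a <∞ +∞
<∞-+∞ (fin _) = tt
<∞-+∞ +∞      = tt

≤∞-trans : ∀ a b c → a ≤∞ b → b ≤∞ c → a ≤∞ c
≤∞-trans a       b       +∞      _   _   = ≤∞-+∞ a
≤∞-trans (fin a) (fin b) (fin c) a≤b b≤c = ℚ.≤-trans a≤b b≤c
≤∞-trans (fin a) +∞      (fin c) _   ()
≤∞-trans +∞      (fin b) (fin c) ()  _
≤∞-trans +∞      +∞      (fin c) _   ()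

≤∞-<∞-trans : ∀ a b c → a ≤∞ b → b <∞ c → a <∞ c
≤∞-<∞-trans a       b       +∞      _   _   = <∞-+∞ a
≤∞-<∞-trans (fin a) (fin b) (fin c) a≤b b<c = ℚ.≤-<-trans a≤b b<c
≤∞-<∞-trans (fin a) +∞      (fin c) _   ()
≤∞-<∞-trans +∞      (fin b) (fin c) ()  _
≤∞-<∞-trans +∞      +∞      (fin c) _   ()

≤∞-antisym : ∀ a b → a ≤∞ b → b ≤∞ a → a ≡ b
≤∞-antisym (fin a) (fin b) a≤b b≤a = cong fin (ℚ.≤-antisym a≤b b≤a)
≤∞-antisym +∞      +∞      _   _   = refl
≤∞-antisym (fin a) +∞      _   ()
≤∞-antisym +∞      (fin b) ()  _

≤∞-total : ∀ a b → a ≤∞ b ⊎ b ≤∞ a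
≤∞-total (fin a) (fin b) = ℚ.≤-total a b
≤∞-total a       +∞      = inj₁ (≤∞-+∞ a)
≤∞-total +∞      (fin b) = inj₂ tt

+∞-≤∞ : ∀ a → +∞ ≤∞ a → a ≡ +∞
+∞-≤∞ +∞      _  = refl
+∞-≤∞ (fin a) ()

<∞⇒≱∞ : ∀ t b → b <∞ fin t → ¬ fin t ≤∞ b
<∞⇒≱∞ t (fin b) b<t t≤b = ℚ.<-irrefl refl (ℚ.<-≤-trans b<t t≤b)

≱∞⇒<∞ : ∀ t b → ¬ fin t ≤∞ b → b <∞ fin t
≱∞⇒<∞ t (fin b) t≰b = ℚ.≰⇒> t≰b
≱∞⇒<∞ t +∞      t≰b = t≰b tt

≤-max∞ˡ : ∀ a b → a ≤∞ max∞ a b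
≤-max∞ˡ (fin a) (fin b) = ℚ.p≤p⊔q a b
≤-max∞ˡ (fin a) +∞      = tt
≤-max∞ˡ +∞      b       = tt

≤-max∞ʳ : ∀ a b → b ≤∞ max∞ a b
≤-max∞ʳ (fin a) (fin b) = ℚ.p≤q⊔p a b
≤-max∞ʳ (fin a) +∞      = tt
≤-max∞ʳ +∞      b       = ≤∞-+∞ b

max∞-lub : ∀ a b c → a ≤∞ c → b ≤∞ c → max∞ a b ≤∞ c
max∞-lub a       b       +∞      _   _   = ≤∞-+∞ (max∞ a b)
max∞-lub (fin a) (fin b) (fin c) a≤c b≤c = ℚ.⊔-lub a≤c b≤c
max∞-lub (fin a) +∞      (fin c) _   ()
max∞-lub +∞      b       (fin c) ()  _

max∞-sel : ∀ a b → max∞ a b ≡ a ⊎ max∞ a b ≡ b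
max∞-sel (fin a) (fin b) = Sum.map (cong fin) (cong fin) (ℚ.⊔-sel a b)
max∞-sel (fin a) +∞      = inj₂ refl
max∞-sel +∞      b       = inj₁ refl

min∞-≤ˡ : ∀ a b → min∞ a b ≤∞ a
min∞-≤ˡ (fin a) (fin b) = ℚ.p⊓q≤p a b
min∞-≤ˡ (fin a) +∞      = ℚ.≤-refl
min∞-≤ˡ +∞      b       = ≤∞-+∞ b

min∞-≤ʳ : ∀ a b → min∞ a b ≤∞ b
min∞-≤ʳ (fin a) (fin b) = ℚ.p⊓q≤q a b
min∞-≤ʳ (fin a) +∞      = tt
min∞-≤ʳ +∞      b       = ≤∞-refl b

min∞-glb : ∀ a b c → c ≤∞ a → c ≤∞ b → c ≤∞ min∞ a b
min∞-glb (fin a) (fin b) (fin c) c≤a c≤b = ℚ.⊓-glb c≤a c≤b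
min∞-glb (fin a) +∞      c       c≤a _   = c≤a
min∞-glb +∞      b       c       _   c≤b = c≤b
min∞-glb (fin a) (fin b) +∞      ()  _

min∞-sel : ∀ a b → min∞ a b ≡ a ⊎ min∞ a b ≡ b
min∞-sel (fin a) (fin b) = Sum.map (cong fin) (cong fin) (ℚ.⊓-sel a b)
min∞-sel (fin a) +∞      = inj₁ refl
min∞-sel +∞      b       = inj₂ refl

max∞-mono : ∀ a b c d → a ≤∞ c → b ≤∞ d → max∞ a b ≤∞ max∞ c d
max∞-mono a b c d a≤c b≤d = max∞-lub a b (max∞ c d)
  (≤∞-trans a c _ a≤c (≤-max∞ˡ c d)) (≤∞-trans b d _ b≤d (≤-max∞ʳ c d))

min∞-mono : ∀ a b c d → a ≤∞ c → b ≤∞ d → min∞ a b ≤∞ min∞ c d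
min∞-mono a b c d a≤c b≤d = min∞-glb c d (min∞ a b)
  (≤∞-trans _ a c (min∞-≤ˡ a b) a≤c) (≤∞-trans _ b d (min∞-≤ʳ a b) b≤d)

≤-max∞ : ∀ c a b → c ≤∞ max∞ a b ⇔ (c ≤∞ a ⊎ c ≤∞ b)
≤-max∞ c a b = mk⇔
  (λ c≤ → Sum.map (λ e → subst (c ≤∞_) e c≤) (λ e → subst (c ≤∞_) e c≤) (max∞-sel a b))
  [ (λ c≤a → ≤∞-trans c a _ c≤a (≤-max∞ˡ a b))
  , (λ c≤b → ≤∞-trans c b _ c≤b (≤-max∞ʳ a b))
  ]′

≤-min∞ : ∀ c a b → c ≤∞ min∞ a b ⇔ (c ≤∞ a × c ≤∞ b)
≤-min∞ c a b = mk⇔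
  (λ c≤ → ≤∞-trans c _ a c≤ (min∞-≤ˡ a b) , ≤∞-trans c _ b c≤ (min∞-≤ʳ a b))
  (λ (c≤a , c≤b) → min∞-glb a b c c≤a c≤b)

max∞-≥ : ∀ a b → b ≤∞ a → max∞ a b ≡ a
max∞-≥ a b b≤a = ≤∞-antisym _ a (max∞-lub a b a (≤∞-refl a) b≤a) (≤-max∞ˡ a b)

max∞-≤ : ∀ a b → a ≤∞ b → max∞ a b ≡ b
max∞-≤ a b a≤b = ≤∞-antisym _ b (max∞-lub a b b a≤b (≤∞-refl b)) (≤-max∞ʳ a b)

min∞-≤ : ∀ a b → a ≤∞ b → min∞ a b ≡ a
min∞-≤ a b a≤b = ≤∞-antisym _ a (min∞-≤ˡ a b) (min∞-glb a b a (≤∞-refl a) a≤b)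

min∞-≥ : ∀ a b → b ≤∞ a → min∞ a b ≡ b
min∞-≥ a b b≤a = ≤∞-antisym _ b (min∞-≤ʳ a b) (min∞-glb a b b b≤a (≤∞-refl b))

Monotone∞ : (ℚ∞ → ℚ∞) → Set
Monotone∞ f = ∀ a b → a ≤∞ b → f a ≤∞ f b

monotone⇒max∞-distrib : ∀ f → Monotone∞ f → ∀ a b → f (max∞ a b) ≡ max∞ (f a) (f b)
monotone⇒max∞-distrib f mono a b with max∞-sel a b
... | inj₁ e = begin
  f (max∞ a b)        ≡⟨ cong f e ⟩
  f a                 ≡⟨ max∞-≥ (f a) (f b) (mono b a (subst (b ≤∞_) e (≤-max∞ʳ a b))) ⟨
  max∞ (f a) (f b)    ∎
... | inj₂ e = begin
  f (max∞ a b)        ≡⟨ cong f e ⟩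
  f b                 ≡⟨ max∞-≤ (f a) (f b) (mono a b (subst (a ≤∞_) e (≤-max∞ˡ a b))) ⟨
  max∞ (f a) (f b)    ∎

monotone⇒min∞-distrib : ∀ f → Monotone∞ f → ∀ a b → f (min∞ a b) ≡ min∞ (f a) (f b)
monotone⇒min∞-distrib f mono a b with min∞-sel a b
... | inj₁ e = begin
  f (min∞ a b)        ≡⟨ cong f e ⟩
  f a                 ≡⟨ min∞-≤ (f a) (f b) (mono a b (subst (_≤∞ b) e (min∞-≤ʳ a b))) ⟨
  min∞ (f a) (f b)    ∎
... | inj₂ e = begin
  f (min∞ a b)        ≡⟨ cong f e ⟩
  f b                 ≡⟨ min∞-≥ (f a) (f b) (mono b a (subst (_≤∞ a) e (min∞-≤ˡ a b))) ⟨
  min∞ (f a) (f b)    ∎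

infixl 6 _⊕_
infixr 7 _·_

_⊕_ : ℚ∞ → ℚ∞ → ℚ∞
fin a ⊕ fin b = fin (a + b)
fin _ ⊕ +∞    = +∞
+∞    ⊕ _     = +∞

_·_ : ℚ → ℚ∞ → ℚ∞
r · fin a = fin (r * a)
r · +∞    = +∞

⊕-identityˡ : ∀ a → fin 0ℚ ⊕ a ≡ a
⊕-identityˡ (fin a) = cong fin (ℚ.+-identityˡ a)
⊕-identityˡ +∞      = refl

⊕-comm : ∀ a b → a ⊕ b ≡ b ⊕ a
⊕-comm (fin a) (fin b) = cong fin (ℚ.+-comm a b)
⊕-comm (fin a) +∞      = refl
⊕-comm +∞      (fin b) = refl
⊕-comm +∞      +∞      = refl

⊕-assoc : ∀ a b c → a ⊕ b ⊕ c ≡ a ⊕ (b ⊕ c)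
⊕-assoc (fin a) (fin b) (fin c) = cong fin (ℚ.+-assoc a b c)
⊕-assoc (fin a) (fin b) +∞      = refl
⊕-assoc (fin a) +∞      c       = refl
⊕-assoc +∞      b       c       = refl

·-distribˡ-⊕ : ∀ r a b → r · (a ⊕ b) ≡ r · a ⊕ r · b
·-distribˡ-⊕ r (fin a) (fin b) = cong fin (ℚ.*-distribˡ-+ r a b)
·-distribˡ-⊕ r (fin a) +∞      = refl
·-distribˡ-⊕ r +∞      b       = refl

*-·-assoc : ∀ r p a → (r * p) · a ≡ r · p · a
*-·-assoc r p (fin a) = cong fin (ℚ.*-assoc r p a)
*-·-assoc r p +∞      = refl

⊕-mono : ∀ a b c d → a ≤∞ c → b ≤∞ d → (a ⊕ b) ≤∞ (c ⊕ d)
⊕-mono (fin a) (fin b) (fin c) (fin d) a≤c b≤d = ℚ.+-mono-≤ a≤c b≤d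
⊕-mono a       b       (fin c) +∞      _   _   = ≤∞-+∞ (a ⊕ b)
⊕-mono a       b       +∞      d       _   _   = ≤∞-+∞ (a ⊕ b)
⊕-mono (fin a) +∞      (fin c) (fin d) _   ()
⊕-mono +∞      b       (fin c) (fin d) ()  _

·-mono : ∀ r .{{_ : NonNegative r}} a b → a ≤∞ b → (r · a) ≤∞ (r · b)
·-mono r (fin a) (fin b) a≤b = ℚ.*-monoˡ-≤-nonNeg r a≤b
·-mono r a       +∞      _   = ≤∞-+∞ (r · a)
·-mono r +∞      (fin b) ()

shift-monoˡ : ∀ c a b → a ≤∞ b → shift a c ≤∞ shift b c
shift-monoˡ c (fin a) (fin b) a≤b = ℚ.+-monoˡ-≤ c a≤b
shift-monoˡ c a       +∞      _   = ≤∞-+∞ (shift a c)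
shift-monoˡ c +∞      (fin b) ()

shift-monoʳ : ∀ a {c d} → c ≤ℚ d → shift a c ≤∞ shift a d
shift-monoʳ (fin a) c≤d = ℚ.+-monoʳ-≤ a c≤d
shift-monoʳ +∞      _   = tt

shift-shift : ∀ a c d → shift (shift a c) d ≡ shift a (c + d)
shift-shift (fin a) c d = cong fin (ℚ.+-assoc a c d)
shift-shift +∞      c d = refl

≤-shift : ∀ a {ε} → 0ℚ ≤ℚ ε → a ≤∞ shift a ε
≤-shift (fin a) {ε} 0≤ε = subst (_≤ℚ a + ε) (ℚ.+-identityʳ a) (ℚ.+-monoʳ-≤ a 0≤ε)
≤-shift +∞      _   = tt

shift-+∞ : ∀ a c → shift a c ≡ +∞ → a ≡ +∞
shift-+∞ +∞ c _ = refl

⊕-leftComm : ∀ a b c → a ⊕ (b ⊕ c) ≡ b ⊕ (a ⊕ c)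
⊕-leftComm a b c = begin
  a ⊕ (b ⊕ c)  ≡⟨ ⊕-assoc a b c ⟨
  a ⊕ b ⊕ c    ≡⟨ cong (_⊕ c) (⊕-comm a b) ⟩
  b ⊕ a ⊕ c    ≡⟨ ⊕-assoc b a c ⟩
  b ⊕ (a ⊕ c)  ∎

·-shift-⊕ : ∀ p a d w b → p · shift a d ⊕ shift b (w * d) ≡ shift (p · a ⊕ b) ((p + w) * d)
·-shift-⊕ p (fin a) d w (fin b) = cong fin
  (solve 5 (λ p a d w b → p :* (a :+ d) :+ (b :+ w :* d) := p :* a :+ b :+ (p :+ w) :* d) refl p a d w b)
·-shift-⊕ p (fin a) d w +∞      = refl
·-shift-⊕ p +∞      d w b       = refl

·-shift-absorb : ∀ β a c′ b c → shift (β · a ⊕ b) (c + β * c′) ≡ shift (β · shift a c′ ⊕ b) c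
·-shift-absorb β (fin a) c′ (fin b) c = cong fin
  (solve 5 (λ β a c′ b c → β :* a :+ b :+ (c :+ β :* c′) := β :* (a :+ c′) :+ b :+ c) refl β a c′ b c)
·-shift-absorb β (fin a) c′ +∞      c = refl
·-shift-absorb β +∞      c′ b       c = refl

<∞-slack : ∀ a b → a <∞ b → Σ ℚ λ ε → 0ℚ <ℚ ε × shift a ε <∞ b
<∞-slack a       +∞      _   = 1ℚ , ℚ.positive⁻¹ 1ℚ , <∞-+∞ (shift a 1ℚ)
<∞-slack (fin a) (fin b) a<b with ℚ.<-dense a<b
... | c , a<c , c<b = c - a , 0<c-a , subst (_<ℚ b) (solve 2 (λ a c → c := a :+ (c :- a)) refl a c) c<b
  where
  0<c-a : 0ℚ <ℚ c - a
  0<c-a = subst (_<ℚ c - a) (ℚ.+-inverseʳ a) (ℚ.+-monoˡ-< (- a) a<c)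

-- Monotone homogeneous systems

_≤ᵛ_ : (x y : Fin m → ℚ∞) → Set
x ≤ᵛ y = ∀ j → x j ≤∞ y j

_+ᵛ_ : (Fin m → ℚ∞) → ℚ → Fin m → ℚ∞
(x +ᵛ d) j = shift (x j) d

Monotone : ((Fin m → ℚ∞) → ℚ∞) → Set
Monotone φ = ∀ x y → x ≤ᵛ y → φ x ≤∞ φ y

Homogeneous : ((Fin m → ℚ∞) → ℚ∞) → Set
Homogeneous φ = ∀ x d → φ (x +ᵛ d) ≡ shift (φ x) d

System : ℕ → Set
System m = Fin m → (Fin m → ℚ∞) → ℚ∞

Primal : System m → Set
Primal {m} f = Σ (Fin m → ℚ) λ x → (i : Fin m) → fin (x i) ≤∞ f i (λ j → fin (x j))

Dual : System m → Set
Dual {m} f = Σ (Fin m → ℚ∞) λ y → (¬ ((i : Fin m) → y i ≡ +∞)) × ((i : Fin m) → f i y <∞ y i)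

Primal-cong : {f g : System m} → (∀ i x → f i x ≡ g i x) → Primal f → Primal g
Primal-cong f≡g (x , x≤fx) = x , λ i → subst (fin (x i) ≤∞_) (f≡g i _) (x≤fx i)

Dual-cong : {f g : System m} → (∀ i x → f i x ≡ g i x) → Dual f → Dual g
Dual-cong f≡g (y , y≢∞ , fy<y) = y , y≢∞ , λ i → subst (_<∞ y i) (f≡g i y) (fy<y i)

argmin∞ : (h : Fin (suc k) → ℚ∞) → Σ (Fin (suc k)) λ i → ∀ j → h i ≤∞ h j
argmin∞ {zero}  h = zero , λ { zero → ≤∞-refl (h zero) }
argmin∞ {suc k} h with argmin∞ (h ∘ suc)
... | i , hi≤ with ≤∞-total (h zero) (h (suc i))
...   | inj₁ h0≤hi = zero  , λ { zero → ≤∞-refl (h zero) ; (suc j) → ≤∞-trans _ _ _ h0≤hi (hi≤ j) }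
...   | inj₂ hi≤h0 = suc i , λ { zero → hi≤h0 ; (suc j) → hi≤ j }

≤-shift-neg⇒ : ∀ a c b → fin b ≤∞ shift a (- c) → fin (c + b) ≤∞ a
≤-shift-neg⇒ (fin a) c b b≤a-c =
  subst (c + b ≤ℚ_) (solve 2 (λ c a → c :+ (a :+ :- c) := a) refl c a) (ℚ.+-monoʳ-≤ c b≤a-c)
≤-shift-neg⇒ +∞      c b _     = tt

primal-dual-exclusive : (f : System m) → (∀ i → Monotone (f i)) → (∀ i → Homogeneous (f i)) →
  Primal f → Dual f → ⊥
primal-dual-exclusive {zero}  f _    _   _          (_ , y≢∞ , _)    = y≢∞ λ ()
primal-dual-exclusive {suc m} f mono hom (x , x≤fx) (y , y≢∞ , fy<y)
  with argmin∞ (λ j → shift (y j) (- x j))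
... | i , i-min with y i in yi≡
...   | +∞ = y≢∞ λ j → shift-+∞ (y j) (- x j) (+∞-≤∞ _ (i-min j))
...   | fin a = <∞⇒≱∞ a (f i y) (subst (f i y <∞_) yi≡ (fy<y i)) a≤fiy
  where
  X : Fin (suc m) → ℚ∞
  X j = fin (x j)
  b : ℚ
  b = a - x i
  X+b≤y : (X +ᵛ b) ≤ᵛ y
  X+b≤y j = ≤-shift-neg⇒ (y j) (x j) b (i-min j)
  a≤fiy : fin a ≤∞ f i y
  a≤fiy = ≤∞-trans (fin a) (f i (X +ᵛ b)) (f i y)
    (subst₂ _≤∞_ (cong fin (solve 2 (λ x a → x :+ (a :- x) := a) refl (x i) a)) (sym (hom i X b))
      (shift-monoˡ b _ _ (x≤fx i)))
    (mono i _ y X+b≤y)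

Terms : ℕ → Set
Terms m = List (Fin m × ℚ⁺)

weightSum : List ℚ⁺ → ℚ
weightSum []             = 0ℚ
weightSum ((p , _) ∷ ps) = p + weightSum ps

weight : Terms m → ℚ
weight ts = weightSum (map proj₂ ts)

linear : Terms m → (Fin m → ℚ∞) → ℚ∞
linear []                   x = fin 0ℚ
linear ((j , (p , _)) ∷ ts) x = p · x j ⊕ linear ts x

weightSum-nonNeg : ∀ ps → NonNegative (weightSum ps)
weightSum-pos : ∀ p ps → Positive (weightSum (p ∷ ps))

weightSum-nonNeg []       = _
weightSum-nonNeg (p ∷ ps) = ℚ.pos⇒nonNeg (weightSum (p ∷ ps)) {{weightSum-pos p ps}}

weightSum-pos (p , p>0) ps = ℚ.pos+nonNeg⇒pos p {{p>0}} (weightSum ps) {{weightSum-nonNeg ps}}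

scale : (r : ℚ) .{{_ : Positive r}} → Terms m → Terms m
scale r []                     = []
scale r ((j , (p , p>0)) ∷ ts) = (j , (r * p , ℚ.pos*pos⇒pos r p {{p>0}})) ∷ scale r ts

weight-scale : ∀ r .{{_ : Positive r}} (ts : Terms m) → weight (scale r ts) ≡ r * weight ts
weight-scale r []                   = sym (ℚ.*-zeroʳ r)
weight-scale r ((j , (p , _)) ∷ ts) = begin
  r * p + weight (scale r ts)  ≡⟨ cong (r * p +_) (weight-scale r ts) ⟩
  r * p + r * weight ts        ≡⟨ ℚ.*-distribˡ-+ r p (weight ts) ⟨
  r * (p + weight ts)          ∎

linear-scale : ∀ r .{{_ : Positive r}} (ts : Terms m) x → linear (scale r ts) x ≡ r · linear ts x
linear-scale r []                   x = cong fin (sym (ℚ.*-zeroʳ r))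
linear-scale r ((j , (p , _)) ∷ ts) x = begin
  (r * p) · x j ⊕ linear (scale r ts) x  ≡⟨ cong₂ _⊕_ (*-·-assoc r p (x j)) (linear-scale r ts x) ⟩
  r · p · x j ⊕ r · linear ts x          ≡⟨ ·-distribˡ-⊕ r _ _ ⟨
  r · (p · x j ⊕ linear ts x)            ∎

module _ {m : ℕ} (t : Fin m × ℚ⁺) (ts : Terms m) where

  weight-pos : Positive (weight (t ∷ ts))
  weight-pos = weightSum-pos (proj₂ t) (map proj₂ ts)

  normaliser : ℚ
  normaliser = (weight (t ∷ ts) ⁻¹) {{weight-pos}}

  normaliser-pos : Positive normaliser
  normaliser-pos = ⁻¹-pos (weight (t ∷ ts)) {{weight-pos}}

  normalise : Terms m
  normalise = scale normaliser {{normaliser-pos}} (t ∷ ts)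

  weight-normalise : weight normalise ≡ 1ℚ
  weight-normalise = trans (weight-scale normaliser {{normaliser-pos}} (t ∷ ts))
    (⁻¹-inverseˡ (weight (t ∷ ts)) {{weight-pos}})

  linear-normalise : ∀ x → linear normalise x ≡ normaliser · linear (t ∷ ts) x
  linear-normalise = linear-scale normaliser {{normaliser-pos}} (t ∷ ts)

weight-++ : ∀ (ts us : Terms m) → weight (ts ++ us) ≡ weight ts + weight us
weight-++ []                   us = sym (ℚ.+-identityˡ (weight us))
weight-++ ((_ , (p , _)) ∷ ts) us =
  trans (cong (p +_) (weight-++ ts us)) (sym (ℚ.+-assoc p (weight ts) (weight us)))

linear-++ : ∀ (ts us : Terms m) x → linear (ts ++ us) x ≡ linear ts x ⊕ linear us x
linear-++ []                   us x = sym (⊕-identityˡ (linear us x))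
linear-++ ((j , (p , _)) ∷ ts) us x =
  trans (cong (p · x j ⊕_) (linear-++ ts us x)) (sym (⊕-assoc (p · x j) _ _))

linear-mono : (ts : Terms m) → Monotone (linear ts)
linear-mono []                     x y x≤y = ℚ.≤-refl
linear-mono ((j , (p , p>0)) ∷ ts) x y x≤y = ⊕-mono _ _ _ _
  (·-mono p {{ℚ.pos⇒nonNeg p {{p>0}}}} (x j) (y j) (x≤y j)) (linear-mono ts x y x≤y)

linear-+ᵛ : ∀ (ts : Terms m) x d → linear ts (x +ᵛ d) ≡ shift (linear ts x) (weight ts * d)
linear-+ᵛ []                   x d = cong fin (sym (trans (ℚ.+-identityˡ (0ℚ * d)) (ℚ.*-zeroˡ d)))
linear-+ᵛ ((j , (p , _)) ∷ ts) x d = begin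
  p · shift (x j) d ⊕ linear ts (x +ᵛ d)
    ≡⟨ cong (p · shift (x j) d ⊕_) (linear-+ᵛ ts x d) ⟩
  p · shift (x j) d ⊕ shift (linear ts x) (weight ts * d)
    ≡⟨ ·-shift-⊕ p (x j) d (weight ts) (linear ts x) ⟩
  shift (p · x j ⊕ linear ts x) ((p + weight ts) * d)
    ∎

-- Unlike weightSum ps · v, this is fin 0ℚ for ps = [] even when v = +∞.
weighted : List ℚ⁺ → ℚ∞ → ℚ∞
weighted []             v = fin 0ℚ
weighted ((p , _) ∷ ps) v = p · v ⊕ weighted ps v

weighted-fin : ∀ ps t → weighted ps (fin t) ≡ fin (weightSum ps * t)
weighted-fin []             t = cong fin (sym (ℚ.*-zeroˡ t))
weighted-fin ((p , _) ∷ ps) t = begin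
  p · fin t ⊕ weighted ps (fin t)  ≡⟨ cong (p · fin t ⊕_) (weighted-fin ps t) ⟩
  fin (p * t + weightSum ps * t)   ≡⟨ cong fin (ℚ.*-distribʳ-+ t p (weightSum ps)) ⟨
  fin ((p + weightSum ps) * t)     ∎

weighted-nonempty : ∀ p ps v → weighted (p ∷ ps) v ≡ weightSum (p ∷ ps) · v
weighted-nonempty p ps (fin t) = weighted-fin (p ∷ ps) t
weighted-nonempty p ps +∞      = refl

selfWeights : Terms (suc m) → List ℚ⁺
selfWeights []                 = []
selfWeights ((zero  , p) ∷ ts) = p ∷ selfWeights ts
selfWeights ((suc _ , _) ∷ ts) = selfWeights ts

others : Terms (suc m) → Terms m
others []                 = []
others ((zero  , _) ∷ ts) = others ts
others ((suc j , p) ∷ ts) = (j , p) ∷ others ts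

weight-split : (ts : Terms (suc m)) → weight ts ≡ weightSum (selfWeights ts) + weight (others ts)
weight-split []                       = sym (ℚ.+-identityˡ 0ℚ)
weight-split ((zero  , (p , _)) ∷ ts) =
  trans (cong (p +_) (weight-split ts)) (sym (ℚ.+-assoc p _ _))
weight-split ((suc j , (p , _)) ∷ ts) = trans (cong (p +_) (weight-split ts))
  (solve 3 (λ p a b → p :+ (a :+ b) := a :+ (p :+ b)) refl p (weightSum (selfWeights ts)) (weight (others ts)))

linear-split : ∀ (ts : Terms (suc m)) v x →
  linear ts (v ∷ᶠ x) ≡ weighted (selfWeights ts) v ⊕ linear (others ts) x
linear-split []                       v x = sym (⊕-identityˡ (fin 0ℚ))
linear-split ((zero  , (p , _)) ∷ ts) v x =
  trans (cong (p · v ⊕_) (linear-split ts v x)) (sym (⊕-assoc (p · v) _ _))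
linear-split ((suc j , (p , _)) ∷ ts) v x =
  trans (cong (p · x j ⊕_) (linear-split ts v x)) (⊕-leftComm (p · x j) _ _)

-- Min-max expressions over affine forms of total weight one

infixr 5 _∨_ _∧_

data Expr (m : ℕ) : Set where
  affine  : (ts : Terms m) → weight ts ≡ 1ℚ → ℚ → Expr m
  top     : Expr m
  _∨_ _∧_ : Expr m → Expr m → Expr m

⟦_⟧ : Expr m → (Fin m → ℚ∞) → ℚ∞
⟦ affine ts _ c ⟧ x = shift (linear ts x) c
⟦ top ⟧           x = +∞
⟦ e ∨ f ⟧         x = max∞ (⟦ e ⟧ x) (⟦ f ⟧ x)
⟦ e ∧ f ⟧         x = min∞ (⟦ e ⟧ x) (⟦ f ⟧ x)

⟦⟧-mono : (e : Expr m) → Monotone ⟦ e ⟧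
⟦⟧-mono (affine ts _ c) x y x≤y = shift-monoˡ c _ _ (linear-mono ts x y x≤y)
⟦⟧-mono top             x y _   = tt
⟦⟧-mono (e ∨ f)         x y x≤y = max∞-mono _ _ _ _ (⟦⟧-mono e x y x≤y) (⟦⟧-mono f x y x≤y)
⟦⟧-mono (e ∧ f)         x y x≤y = min∞-mono _ _ _ _ (⟦⟧-mono e x y x≤y) (⟦⟧-mono f x y x≤y)

⟦⟧-homogeneous : (e : Expr m) → Homogeneous ⟦ e ⟧
⟦⟧-homogeneous (affine ts w≡1 c) x d = begin
  shift (linear ts (x +ᵛ d)) c                   ≡⟨ cong (λ u → shift u c) (linear-+ᵛ ts x d) ⟩
  shift (shift (linear ts x) (weight ts * d)) c  ≡⟨ shift-shift (linear ts x) _ c ⟩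
  shift (linear ts x) (weight ts * d + c)        ≡⟨ cong (λ w → shift (linear ts x) (w * d + c)) w≡1 ⟩
  shift (linear ts x) (1ℚ * d + c)               ≡⟨ cong (shift (linear ts x)) d+c≡c+d ⟩
  shift (linear ts x) (c + d)                    ≡⟨ shift-shift (linear ts x) c d ⟨
  shift (shift (linear ts x) c) d                ∎
  where
  d+c≡c+d : 1ℚ * d + c ≡ c + d
  d+c≡c+d = trans (cong (_+ c) (ℚ.*-identityˡ d)) (ℚ.+-comm d c)
⟦⟧-homogeneous top     x d = refl
⟦⟧-homogeneous (e ∨ f) x d = begin
  max∞ (⟦ e ⟧ (x +ᵛ d)) (⟦ f ⟧ (x +ᵛ d))
    ≡⟨ cong₂ max∞ (⟦⟧-homogeneous e x d) (⟦⟧-homogeneous f x d) ⟩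
  max∞ (shift (⟦ e ⟧ x) d) (shift (⟦ f ⟧ x) d)
    ≡⟨ monotone⇒max∞-distrib (λ u → shift u d) (shift-monoˡ d) (⟦ e ⟧ x) (⟦ f ⟧ x) ⟨
  shift (max∞ (⟦ e ⟧ x) (⟦ f ⟧ x)) d
    ∎
⟦⟧-homogeneous (e ∧ f) x d = begin
  min∞ (⟦ e ⟧ (x +ᵛ d)) (⟦ f ⟧ (x +ᵛ d))
    ≡⟨ cong₂ min∞ (⟦⟧-homogeneous e x d) (⟦⟧-homogeneous f x d) ⟩
  min∞ (shift (⟦ e ⟧ x) d) (shift (⟦ f ⟧ x) d)
    ≡⟨ monotone⇒min∞-distrib (λ u → shift u d) (shift-monoˡ d) (⟦ e ⟧ x) (⟦ f ⟧ x) ⟨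
  shift (min∞ (⟦ e ⟧ x) (⟦ f ⟧ x)) d
    ∎

mix : (β : ℚ) .{{_ : Positive β}} → Expr m → (R : Terms m) → β + weight R ≡ 1ℚ → ℚ → Expr m
mix β (affine qs q≡1 c′) R eq c = affine (scale β qs ++ R) w≡1 (c + β * c′)
  where
  w≡1 : weight (scale β qs ++ R) ≡ 1ℚ
  w≡1 = begin
    weight (scale β qs ++ R)        ≡⟨ weight-++ (scale β qs) R ⟩
    weight (scale β qs) + weight R  ≡⟨ cong (_+ weight R) (weight-scale β qs) ⟩
    β * weight qs + weight R        ≡⟨ cong (λ w → β * w + weight R) q≡1 ⟩
    β * 1ℚ + weight R               ≡⟨ cong (_+ weight R) (ℚ.*-identityʳ β) ⟩
    β + weight R                    ≡⟨ eq ⟩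
    1ℚ                              ∎
mix β top     R eq c = top
mix β (e ∨ f) R eq c = mix β e R eq c ∨ mix β f R eq c
mix β (e ∧ f) R eq c = mix β e R eq c ∧ mix β f R eq c

·-⊕-shift-mono : ∀ β .{{_ : Positive β}} b c → Monotone∞ (λ a → shift (β · a ⊕ b) c)
·-⊕-shift-mono β b c a a′ a≤a′ =
  shift-monoˡ c _ _ (⊕-mono _ b _ b (·-mono β {{ℚ.pos⇒nonNeg β}} a a′ a≤a′) (≤∞-refl b))

⟦mix⟧ : ∀ β .{{_ : Positive β}} (g : Expr m) R eq c x →
  ⟦ mix β g R eq c ⟧ x ≡ shift (β · ⟦ g ⟧ x ⊕ linear R x) c
⟦mix⟧ β (affine qs _ c′) R eq c x = begin
  shift (linear (scale β qs ++ R) x) (c + β * c′)    ≡⟨ cong (λ u → shift u (c + β * c′)) linear-mixed ⟩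
  shift (β · linear qs x ⊕ linear R x) (c + β * c′)  ≡⟨ ·-shift-absorb β (linear qs x) c′ (linear R x) c ⟩
  shift (β · shift (linear qs x) c′ ⊕ linear R x) c  ∎
  where
  linear-mixed : linear (scale β qs ++ R) x ≡ β · linear qs x ⊕ linear R x
  linear-mixed = trans (linear-++ (scale β qs) R x) (cong (_⊕ linear R x) (linear-scale β qs x))
⟦mix⟧ β top     R eq c x = refl
⟦mix⟧ β (e ∨ f) R eq c x = trans (cong₂ max∞ (⟦mix⟧ β e R eq c x) (⟦mix⟧ β f R eq c x))
  (sym (monotone⇒max∞-distrib _ (·-⊕-shift-mono β (linear R x) c) (⟦ e ⟧ x) (⟦ f ⟧ x)))
⟦mix⟧ β (e ∧ f) R eq c x = trans (cong₂ min∞ (⟦mix⟧ β e R eq c x) (⟦mix⟧ β f R eq c x))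
  (sym (monotone⇒min∞-distrib _ (·-⊕-shift-mono β (linear R x) c) (⟦ e ⟧ x) (⟦ f ⟧ x)))

substAffine : (ps : List ℚ⁺) (R : Terms m) → weightSum ps + weight R ≡ 1ℚ → ℚ → Expr m → Expr m
substAffine []       R eq c g = affine R (trans (sym (ℚ.+-identityˡ (weight R))) eq) c
substAffine (p ∷ ps) R eq c g = mix (weightSum (p ∷ ps)) {{weightSum-pos p ps}} g R eq c

⟦substAffine⟧ : ∀ ps (R : Terms m) eq c g x →
  ⟦ substAffine ps R eq c g ⟧ x ≡ shift (weighted ps (⟦ g ⟧ x) ⊕ linear R x) c
⟦substAffine⟧ []       R eq c g x = cong (λ u → shift u c) (sym (⊕-identityˡ (linear R x)))
⟦substAffine⟧ (p ∷ ps) R eq c g x = trans (⟦mix⟧ (weightSum (p ∷ ps)) {{weightSum-pos p ps}} g R eq c x)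
  (cong (λ u → shift (u ⊕ linear R x) c) (sym (weighted-nonempty p ps (⟦ g ⟧ x))))

infixl 8 _[_]

_[_] : Expr (suc m) → Expr m → Expr m
affine ts eq c [ g ] = substAffine (selfWeights ts) (others ts) (trans (sym (weight-split ts)) eq) c g
top            [ g ] = top
(e ∨ f)        [ g ] = e [ g ] ∨ f [ g ]
(e ∧ f)        [ g ] = e [ g ] ∧ f [ g ]

⟦[]⟧ : ∀ (e : Expr (suc m)) g x → ⟦ e [ g ] ⟧ x ≡ ⟦ e ⟧ (⟦ g ⟧ x ∷ᶠ x)
⟦[]⟧ (affine ts eq c) g x = trans (⟦substAffine⟧ (selfWeights ts) (others ts) _ c g x)
  (cong (λ u → shift u c) (sym (linear-split ts (⟦ g ⟧ x) x)))
⟦[]⟧ top     g x = refl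
⟦[]⟧ (e ∨ f) g x = cong₂ max∞ (⟦[]⟧ e g x) (⟦[]⟧ f g x)
⟦[]⟧ (e ∧ f) g x = cong₂ min∞ (⟦[]⟧ e g x) (⟦[]⟧ f g x)

data Bound (m : ℕ) : Set where
  unsatisfiable : Bound m
  atMost        : Expr m → Bound m

Below : ℚ → Bound m → (Fin m → ℚ∞) → Set
Below t unsatisfiable x = ⊥
Below t (atMost g)    x = fin t ≤∞ ⟦ g ⟧ x

_∨ᵇ_ : Bound m → Bound m → Bound m
unsatisfiable ∨ᵇ B             = B
atMost g      ∨ᵇ unsatisfiable = atMost g
atMost g      ∨ᵇ atMost h      = atMost (g ∨ h)

_∧ᵇ_ : Bound m → Bound m → Bound m
unsatisfiable ∧ᵇ B             = unsatisfiable
atMost g      ∧ᵇ unsatisfiable = unsatisfiable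
atMost g      ∧ᵇ atMost h      = atMost (g ∧ h)

Below-∨ᵇ : ∀ t (A B : Bound m) x → Below t (A ∨ᵇ B) x ⇔ (Below t A x ⊎ Below t B x)
Below-∨ᵇ t unsatisfiable B             x = mk⇔ inj₂ [ (λ ()) , (λ b → b) ]′
Below-∨ᵇ t (atMost g)    unsatisfiable x = mk⇔ inj₁ [ (λ a → a) , (λ ()) ]′
Below-∨ᵇ t (atMost g)    (atMost h)    x = ≤-max∞ (fin t) (⟦ g ⟧ x) (⟦ h ⟧ x)

Below-∧ᵇ : ∀ t (A B : Bound m) x → Below t (A ∧ᵇ B) x ⇔ (Below t A x × Below t B x)
Below-∧ᵇ t unsatisfiable B             x = mk⇔ (λ ()) (λ { (() , _) })
Below-∧ᵇ t (atMost g)    unsatisfiable x = mk⇔ (λ ()) (λ { (_ , ()) })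
Below-∧ᵇ t (atMost g)    (atMost h)    x = ≤-min∞ (fin t) (⟦ g ⟧ x) (⟦ h ⟧ x)

isolateAffine : Terms m → ℚ → Bound m
isolateAffine []       c with 0ℚ ℚ.≤? c
... | yes _ = atMost top
... | no  _ = unsatisfiable
isolateAffine (r ∷ rs) c = atMost (affine (normalise r rs) (weight-normalise r rs) (normaliser r rs * c))

≤-isolate : ∀ β w .{{_ : Positive w}} t S c → β + w ≡ 1ℚ →
  fin t ≤∞ shift (fin (β * t) ⊕ S) c ⇔ fin t ≤∞ shift (w ⁻¹ · S) (w ⁻¹ * c)
≤-isolate β w t (fin s) c β+w≡1 =
  ⇔.trans (≤-absorb β w t s c β+w≡1) (⇔.trans (*-≤⇔≤-⁻¹* w t (s + c))
    (subst (λ z → t ≤ℚ w ⁻¹ * (s + c) ⇔ t ≤ℚ z) (ℚ.*-distribˡ-+ (w ⁻¹) s c) ⇔.refl))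
≤-isolate β w t +∞      c _     = mk⇔ (λ _ → tt) (λ _ → tt)

isolateAffine-correct : ∀ β (R : Terms m) c x t → β + weight R ≡ 1ℚ →
  fin t ≤∞ shift (fin (β * t) ⊕ linear R x) c ⇔ Below t (isolateAffine R c) x
isolateAffine-correct β [] c x t β+0≡1 with 0ℚ ℚ.≤? c
... | yes 0≤c = mk⇔ (λ _ → tt) (λ _ → from (≤-absorb β 0ℚ t 0ℚ c β+0≡1)
  (subst₂ _≤ℚ_ (sym (ℚ.*-zeroˡ t)) (sym (ℚ.+-identityˡ c)) 0≤c))
... | no  0≰c = mk⇔ (λ t≤ → 0≰c (subst₂ _≤ℚ_ (ℚ.*-zeroˡ t) (ℚ.+-identityˡ c)
  (to (≤-absorb β 0ℚ t 0ℚ c β+0≡1) t≤))) (λ ())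
isolateAffine-correct β R@(r ∷ rs) c x t β+W≡1 =
  subst (λ u → fin t ≤∞ shift (fin (β * t) ⊕ linear R x) c ⇔ fin t ≤∞ shift u (normaliser r rs * c))
    (sym (linear-normalise r rs x)) (≤-isolate β (weight R) {{weight-pos r rs}} t (linear R x) c β+W≡1)

isolate : Expr (suc m) → Bound m
isolate (affine ts _ c) = isolateAffine (others ts) c
isolate top             = atMost top
isolate (e ∨ f)         = isolate e ∨ᵇ isolate f
isolate (e ∧ f)         = isolate e ∧ᵇ isolate f

isolate-correct : ∀ (e : Expr (suc m)) y t → fin t ≤∞ ⟦ e ⟧ (fin t ∷ᶠ y) ⇔ Below t (isolate e) y
isolate-correct (affine ts eq c) y t
  rewrite linear-split ts (fin t) y | weighted-fin (selfWeights ts) t =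
  isolateAffine-correct (weightSum (selfWeights ts)) (others ts) c y t (trans (sym (weight-split ts)) eq)
isolate-correct top     y t = mk⇔ (λ _ → tt) (λ _ → tt)
isolate-correct (e ∨ f) y t = ⇔.trans (≤-max∞ (fin t) _ _)
  (⇔.trans (isolate-correct e y t ⊎-⇔ isolate-correct f y t)
    (⇔.sym (Below-∨ᵇ t (isolate e) (isolate f) y)))
isolate-correct (e ∧ f) y t = ⇔.trans (≤-min∞ (fin t) _ _)
  (⇔.trans (isolate-correct e y t ×-⇔ isolate-correct f y t)
    (⇔.sym (Below-∧ᵇ t (isolate e) (isolate f) y)))

isolate-≤ : ∀ (e : Expr (suc m)) {g} y t → isolate e ≡ atMost g →
  fin t ≤∞ ⟦ g ⟧ y → fin t ≤∞ ⟦ e ⟧ (fin t ∷ᶠ y)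
isolate-≤ e y t eq t≤g = from (isolate-correct e y t) (subst (λ B → Below t B y) (sym eq) t≤g)

isolate-< : ∀ (e : Expr (suc m)) {g} y u → isolate e ≡ atMost g →
  ⟦ g ⟧ y <∞ u → ⟦ e ⟧ (u ∷ᶠ y) <∞ u
isolate-< e y +∞      _  _   = <∞-+∞ _
isolate-< e y (fin t) eq g<t = ≱∞⇒<∞ t _ λ t≤e →
  <∞⇒≱∞ t _ g<t (subst (λ B → Below t B y) eq (to (isolate-correct e y t) t≤e))

isolate-unsatisfiable : ∀ (e : Expr (suc m)) y t → isolate e ≡ unsatisfiable →
  ⟦ e ⟧ (fin t ∷ᶠ y) <∞ fin t
isolate-unsatisfiable e y t eq = ≱∞⇒<∞ t _ λ t≤e →
  subst (λ B → Below t B y) eq (to (isolate-correct e y t) t≤e)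

-- Eliminating the first variable

Eventually : (ℚ → Set) → Set
Eventually P = Σ ℚ λ T → ∀ t → T ≤ℚ t → P t

eventually-mono : {P Q : ℚ → Set} → (∀ {t} → P t → Q t) → Eventually P → Eventually Q
eventually-mono P⇒Q (T , ev) = T , λ t T≤t → P⇒Q (ev t T≤t)

eventually-× : {P Q : ℚ → Set} → Eventually P → Eventually Q → Eventually (λ t → P t × Q t)
eventually-× (T , evP) (U , evQ) = T ⊔ U , λ t T⊔U≤t →
  evP t (ℚ.≤-trans (ℚ.p≤p⊔q T U) T⊔U≤t) , evQ t (ℚ.≤-trans (ℚ.p≤q⊔p T U) T⊔U≤t)

eventually-∀ : {P : Fin k → ℚ → Set} → (∀ i → Eventually (P i)) → Eventually (λ t → ∀ i → P i t)
eventually-∀ {zero}  _  = 0ℚ , λ _ _ ()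
eventually-∀ {suc k} ev = eventually-mono (λ { (p , ps) zero → p ; (p , ps) (suc i) → ps i })
  (eventually-× (ev zero) (eventually-∀ (ev ∘ suc)))

eventually-≤-*+ : ∀ β .{{_ : Positive β}} C s → Eventually (λ t → C ≤ℚ β * t + s)
eventually-≤-*+ β C s = β ⁻¹ * (C - s) , λ t T≤t →
  subst (_≤ℚ β * t + s) C≡ (ℚ.+-monoˡ-≤ s (ℚ.*-monoˡ-≤-nonNeg β {{ℚ.pos⇒nonNeg β}} T≤t))
  where
  C≡ : β * (β ⁻¹ * (C - s)) + s ≡ C
  C≡ = trans (cong (_+ s) (*⁻¹-cancel β (C - s))) (solve 2 (λ C s → C :- s :+ s := C) refl C s)

weighted-eventually : ∀ ps b c C → fin C ≤∞ shift (weighted ps +∞ ⊕ b) c →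
  Eventually (λ t → fin C ≤∞ shift (weighted ps (fin t) ⊕ b) c)
weighted-eventually []       b       c C C≤ = 0ℚ , λ _ _ → C≤
weighted-eventually (p ∷ ps) +∞      c C _  = 0ℚ , λ t _ →
  subst (λ u → fin C ≤∞ shift (u ⊕ +∞) c) (sym (weighted-fin (p ∷ ps) t)) tt
weighted-eventually (p ∷ ps) (fin b) c C _  = eventually-mono
  (λ {t} C≤ → subst (λ u → fin C ≤∞ shift (u ⊕ fin b) c) (sym (weighted-fin (p ∷ ps) t))
    (subst (C ≤ℚ_) (sym (ℚ.+-assoc (weightSum (p ∷ ps) * t) b c)) C≤))
  (eventually-≤-*+ (weightSum (p ∷ ps)) {{weightSum-pos p ps}} C (b + c))

⟦⟧-eventually : ∀ (e : Expr (suc m)) C y → fin C ≤∞ ⟦ e ⟧ (+∞ ∷ᶠ y) →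
  Eventually (λ t → fin C ≤∞ ⟦ e ⟧ (fin t ∷ᶠ y))
⟦⟧-eventually (affine ts _ c) C y C≤ = eventually-mono
  (λ {t} → subst (λ u → fin C ≤∞ shift u c) (sym (linear-split ts (fin t) y)))
  (weighted-eventually (selfWeights ts) (linear (others ts) y) c C
    (subst (λ u → fin C ≤∞ shift u c) (linear-split ts +∞ y) C≤))
⟦⟧-eventually top     C y _  = 0ℚ , λ _ _ → tt
⟦⟧-eventually (e ∨ f) C y C≤ with to (≤-max∞ (fin C) _ _) C≤
... | inj₁ C≤e = eventually-mono (from (≤-max∞ (fin C) _ _) ∘ inj₁) (⟦⟧-eventually e C y C≤e)
... | inj₂ C≤f = eventually-mono (from (≤-max∞ (fin C) _ _) ∘ inj₂) (⟦⟧-eventually f C y C≤f)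
⟦⟧-eventually (e ∧ f) C y C≤ =
  let (C≤e , C≤f) = to (≤-min∞ (fin C) _ _) C≤ in
  eventually-mono (from (≤-min∞ (fin C) _ _))
    (eventually-× (⟦⟧-eventually e C y C≤e) (⟦⟧-eventually f C y C≤f))

⟦_⟧ˢ : (Fin m → Expr m) → System m
⟦ F ⟧ˢ i = ⟦ F i ⟧

finite-below : ∀ v (E : Fin k → Expr (suc m)) y (C : Fin k → ℚ) →
  (∀ i → fin (C i) ≤∞ ⟦ E i ⟧ (v ∷ᶠ y)) →
  Σ ℚ λ t → fin t ≤∞ v × ∀ i → fin (C i) ≤∞ ⟦ E i ⟧ (fin t ∷ᶠ y)
finite-below (fin a) E y C C≤E = a , ℚ.≤-refl , C≤E
finite-below +∞      E y C C≤E =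
  let (T , ev) = eventually-∀ (λ i → ⟦⟧-eventually (E i) (C i) y (C≤E i)) in T , tt , ev T ℚ.≤-refl

⟦⟧-head-nonexpansive : ∀ (e : Expr (suc m)) a {ε} y → 0ℚ ≤ℚ ε →
  ⟦ e ⟧ (fin (a + ε) ∷ᶠ y) ≤∞ shift (⟦ e ⟧ (fin a ∷ᶠ y)) ε
⟦⟧-head-nonexpansive e a {ε} y 0≤ε =
  subst (⟦ e ⟧ (fin (a + ε) ∷ᶠ y) ≤∞_) (⟦⟧-homogeneous e (fin a ∷ᶠ y) ε)
    (⟦⟧-mono e _ _ pointwise)
  where
  pointwise : (fin (a + ε) ∷ᶠ y) ≤ᵛ ((fin a ∷ᶠ y) +ᵛ ε)
  pointwise zero    = ℚ.≤-refl
  pointwise (suc j) = ≤-shift (y j) 0≤ε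

strict-above : ∀ v (E : Fin k → Expr (suc m)) y (z : Fin k → ℚ∞) →
  (∀ i → ⟦ E i ⟧ (v ∷ᶠ y) <∞ z i) →
  Σ ℚ∞ λ u → v <∞ u × ∀ i → ⟦ E i ⟧ (u ∷ᶠ y) <∞ z i
strict-above +∞      E y z E<z = +∞ , tt , E<z
strict-above (fin a) E y z E<z =
  let (ε , ε>0 , ε≤δ) = positiveLowerBound (proj₁ ∘ slack) (proj₁ ∘ proj₂ ∘ slack) in
  fin (a + ε) , p<p+q a ε>0 , λ i → ≤∞-<∞-trans _ _ (z i)
    (≤∞-trans _ _ _ (⟦⟧-head-nonexpansive (E i) a y (ℚ.<⇒≤ ε>0)) (shift-monoʳ _ (ε≤δ i)))
    (proj₂ (proj₂ (slack i)))
  where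
  slack : ∀ i → Σ ℚ λ δ → 0ℚ <ℚ δ × shift (⟦ E i ⟧ (fin a ∷ᶠ y)) δ <∞ z i
  slack i = <∞-slack _ (z i) (E<z i)

fin-∷ᶠ : ∀ t (x : Fin m → ℚ) → (fin t ∷ᶠ λ j → fin (x j)) ≤ᵛ (λ j → fin ((t ∷ᶠ x) j))
fin-∷ᶠ t x zero    = ℚ.≤-refl
fin-∷ᶠ t x (suc j) = ℚ.≤-refl

fin≢+∞ : ∀ {a} → fin a ≡ +∞ → ⊥
fin≢+∞ ()

module Elimination {m : ℕ} (F : Fin (suc m) → Expr (suc m)) where

  reduced : Expr m → Fin m → Expr m
  reduced g i = F (suc i) [ g ]

  unsatisfiable⇒dual : isolate (F zero) ≡ unsatisfiable → Dual ⟦ F ⟧ˢ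
  unsatisfiable⇒dual eq = y , (λ all∞ → fin≢+∞ (all∞ zero)) , rows
    where
    y : Fin (suc m) → ℚ∞
    y = fin 0ℚ ∷ᶠ λ _ → +∞
    rows : ∀ i → ⟦ F i ⟧ y <∞ y i
    rows zero    = isolate-unsatisfiable (F zero) _ 0ℚ eq
    rows (suc i) = <∞-+∞ _

  primal-lift : ∀ {g} → isolate (F zero) ≡ atMost g → Primal ⟦ reduced g ⟧ˢ → Primal ⟦ F ⟧ˢ
  primal-lift {g} eq (x′ , x′≤) =
    let (t , t≤g , rows) = finite-below (⟦ g ⟧ X′) (F ∘ suc) X′ x′ x′≤substituted
    in (t ∷ᶠ x′) , λ where
      zero    → ≤∞-trans _ _ _ (isolate-≤ (F zero) X′ t eq t≤g)
                  (⟦⟧-mono (F zero) _ _ (fin-∷ᶠ t x′))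
      (suc i) → ≤∞-trans _ _ _ (rows i) (⟦⟧-mono (F (suc i)) _ _ (fin-∷ᶠ t x′))
    where
    X′ : Fin m → ℚ∞
    X′ j = fin (x′ j)
    x′≤substituted : ∀ i → fin (x′ i) ≤∞ ⟦ F (suc i) ⟧ (⟦ g ⟧ X′ ∷ᶠ X′)
    x′≤substituted i = subst (fin (x′ i) ≤∞_) (⟦[]⟧ (F (suc i)) g X′) (x′≤ i)

  dual-lift : ∀ {g} → isolate (F zero) ≡ atMost g → Dual ⟦ reduced g ⟧ˢ → Dual ⟦ F ⟧ˢ
  dual-lift {g} eq (y′ , y′≢∞ , F<y′) =
    let (u , g<u , rows) = strict-above (⟦ g ⟧ y′) (F ∘ suc) y′ y′ substituted<y′
    in (u ∷ᶠ y′) , (λ all∞ → y′≢∞ (all∞ ∘ suc)) , λ where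
      zero    → isolate-< (F zero) y′ u eq g<u
      (suc i) → rows i
    where
    substituted<y′ : ∀ i → ⟦ F (suc i) ⟧ (⟦ g ⟧ y′ ∷ᶠ y′) <∞ y′ i
    substituted<y′ i = subst (_<∞ y′ i) (⟦[]⟧ (F (suc i)) g y′) (F<y′ i)

primal-or-dual : ∀ m (F : Fin m → Expr m) → Primal ⟦ F ⟧ˢ ⊎ Dual ⟦ F ⟧ˢ
primal-or-dual zero    F = inj₁ ((λ ()) , λ ())
primal-or-dual (suc m) F with isolate (F zero) in eq
... | unsatisfiable = inj₂ (Elimination.unsatisfiable⇒dual F eq)
... | atMost g      = Sum.map (Elimination.primal-lift F eq) (Elimination.dual-lift F eq)
  (primal-or-dual m (Elimination.reduced F g))

shiftVar : Fin m → ℚ → Expr m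
shiftVar j k = affine ((j , (1ℚ , _)) ∷ []) refl k

⟦shiftVar⟧ : ∀ (j : Fin m) k x → ⟦ shiftVar j k ⟧ x ≡ shift (x j) k
⟦shiftVar⟧ j k x with x j
... | fin a = cong (λ z → fin (z + k)) (trans (ℚ.+-identityʳ (1ℚ * a)) (ℚ.*-identityˡ a))
... | +∞    = refl

compileMax : Fin m × ℚ → List (Fin m × ℚ) → Expr m
compileMax (j , k) []       = shiftVar j k
compileMax (j , k) (t ∷ ts) = shiftVar j k ∨ compileMax t ts

⟦compileMax⟧ : ∀ (t : Fin m × ℚ) ts x → ⟦ compileMax t ts ⟧ x ≡ maxTerms′ x t ts
⟦compileMax⟧ (j , k) []       x = ⟦shiftVar⟧ j k x
⟦compileMax⟧ (j , k) (t ∷ ts) x = cong₂ max∞ (⟦shiftVar⟧ j k x) (⟦compileMax⟧ t ts x)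

compileMin : Fin m × ℚ → List (Fin m × ℚ) → Expr m
compileMin (j , k) []       = shiftVar j k
compileMin (j , k) (t ∷ ts) = shiftVar j k ∧ compileMin t ts

⟦compileMin⟧ : ∀ (t : Fin m × ℚ) ts x → ⟦ compileMin t ts ⟧ x ≡ minTerms′ x t ts
⟦compileMin⟧ (j , k) []       x = ⟦shiftVar⟧ j k x
⟦compileMin⟧ (j , k) (t ∷ ts) x = cong₂ min∞ (⟦shiftVar⟧ j k x) (⟦compileMin⟧ t ts x)

weightedSum′≡linear : ∀ x (t : Fin m × ℚ⁺) ts → weightedSum′ x t ts ≡ linear (t ∷ ts) x
weightedSum′≡linear x (j , (a , _)) [] with x j
... | fin v = cong fin (sym (ℚ.+-identityʳ (a * v)))
... | +∞    = refl
weightedSum′≡linear x (j , (a , _)) (t ∷ ts) with x j | weightedSum′ x t ts | weightedSum′≡linear x t ts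
... | fin v | fin s | eq = cong (fin (a * v) ⊕_) eq
... | fin v | +∞    | eq = cong (fin (a * v) ⊕_) eq
... | +∞    | _     | _  = refl

totalWeight′≡weight : ∀ (t : Fin m × ℚ⁺) ts → proj₁ (totalWeight′ t ts) ≡ weight (t ∷ ts)
totalWeight′≡weight (j , (a , _)) []       = sym (ℚ.+-identityʳ a)
totalWeight′≡weight (j , (a , _)) (t ∷ ts) with totalWeight′ t ts | totalWeight′≡weight t ts
... | _ | eq = cong (a +_) eq

average : ℚ∞ → ℚ⁺ → ℚ → ℚ∞
average (fin s) (w , w>0) k = fin ((s ÷ w) {{ℚ.pos⇒nonZero w {{w>0}}}} + k)
average +∞      _         k = +∞

eval-avgOp : ∀ ts k (x : Fin m → ℚ∞) → eval (avgOp ts k) x ≡ average (weightedSum x ts) (totalWeight ts) k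
eval-avgOp ts k x with weightedSum x ts | totalWeight ts
... | fin s | _ = refl
... | +∞    | _ = refl

average-≡ : ∀ w .{{_ : Positive w}} S (tw : ℚ⁺) k → proj₁ tw ≡ w →
  shift (w ⁻¹ · S) k ≡ average S tw k
average-≡ w (fin s) (.w , _) k refl = cong (λ z → fin (z + k)) (ℚ.*-comm (w ⁻¹) s)
average-≡ w +∞      _        k _    = refl

compileAvg : List⁺ (Fin m × ℚ⁺) → ℚ → Expr m
compileAvg (t ∷⁺ ts) k = affine (normalise t ts) (weight-normalise t ts) k

⟦compileAvg⟧ : ∀ ts k (x : Fin m → ℚ∞) → ⟦ compileAvg ts k ⟧ x ≡ eval (avgOp ts k) x
⟦compileAvg⟧ (t ∷⁺ ts) k x = begin
  shift (linear (normalise t ts) x) k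
    ≡⟨ cong (λ u → shift u k) (linear-normalise t ts x) ⟩
  shift (normaliser t ts · linear (t ∷ ts) x) k
    ≡⟨ cong (λ u → shift (normaliser t ts · u) k) (weightedSum′≡linear x t ts) ⟨
  shift (normaliser t ts · weightedSum′ x t ts) k
    ≡⟨ average-≡ (weight (t ∷ ts)) {{weight-pos t ts}} _ (totalWeight′ t ts) k (totalWeight′≡weight t ts) ⟩
  average (weightedSum′ x t ts) (totalWeight′ t ts) k
    ≡⟨ eval-avgOp (t ∷⁺ ts) k x ⟨
  eval (avgOp (t ∷⁺ ts) k) x
    ∎

compile : Op m → Expr m
compile (maxOp (t ∷⁺ ts)) = compileMax t ts
compile (minOp (t ∷⁺ ts)) = compileMin t ts
compile (avgOp ts k)      = compileAvg ts k

⟦compile⟧ : ∀ (o : Op m) x → ⟦ compile o ⟧ x ≡ eval o x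
⟦compile⟧ (maxOp (t ∷⁺ ts)) = ⟦compileMax⟧ t ts
⟦compile⟧ (minOp (t ∷⁺ ts)) = ⟦compileMin⟧ t ts
⟦compile⟧ (avgOp ts k)      = ⟦compileAvg⟧ ts k

eval-mono : (o : Op m) → Monotone (eval o)
eval-mono o x y x≤y = subst₂ _≤∞_ (⟦compile⟧ o x) (⟦compile⟧ o y) (⟦⟧-mono (compile o) x y x≤y)

eval-homogeneous : (o : Op m) → Homogeneous (eval o)
eval-homogeneous o x d = begin
  eval o (x +ᵛ d)              ≡⟨ ⟦compile⟧ o (x +ᵛ d) ⟨
  ⟦ compile o ⟧ (x +ᵛ d)       ≡⟨ ⟦⟧-homogeneous (compile o) x d ⟩
  shift (⟦ compile o ⟧ x) d    ≡⟨ cong (λ u → shift u d) (⟦compile⟧ o x) ⟩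
  shift (eval o x) d           ∎

mainTheorem5 : (n : ℕ) → 1 ≤ n → (o : Fin n → Op n) →
    (P′ o ⊎ D′ o) × ¬ (P′ o × D′ o)
mainTheorem5 n _ o =
  Sum.map (Primal-cong ⟦compile⟧ᵢ) (Dual-cong ⟦compile⟧ᵢ) (primal-or-dual n (compile ∘ o)) ,
  λ (p , d) → primal-dual-exclusive (λ i → eval (o i)) (eval-mono ∘ o) (eval-homogeneous ∘ o) p d
  where
  ⟦compile⟧ᵢ : ∀ i x → ⟦ compile (o i) ⟧ x ≡ eval (o i) x
  ⟦compile⟧ᵢ i = ⟦compile⟧ (o i)
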